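{- Let $M$ be a rank $k$ matroid on $[n]$. Then $M$ is $2$-uniform assumable if and only if for all bases $B_1,B_2$ of $M$ and all non-bases $D_1,D_2\in\binom{[n]}{k}\setminus M$, we have $B_1\cup B_2\neq D_1\cup D_2$ or $B_1\cap B_2\neq D_1\cap D_2$.
   Context: For words/sets $A,B$ over $[n]$, the sorted concatenation $A+B$ is the weakly increasing word in which each $i\in[n]$ appears as many times as in $A$ and $B$ combined (i.e. the multiset union). For $\ell>1$, a rank $k$ matroid $M$ on $[n]$ (identified with its set of bases) is $\ell$-uniform assumable if for all bases $B_1,\dots,B_\ell\in M$ and all $D_1,\dots,D_\ell\in\binom{[n]}{k}\setminus M$, $B_1+\dots+B_\ell\neq D_1+\dots+D_\ell$. -}

module Defs where

open import Data.Nat using (ℕ; zero; suc; _+_)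
open import Data.Fin using (Fin)
open import Data.Fin.Subset using (Subset; Side; inside; outside; _∈_; _∉_; _∪_; _-_; ⁅_⁆; ∣_∣)
open import Data.Vec using (Vec; lookup)
open import Data.List using (List; concatMap; replicate; allFin)
open import Data.Product using (Σ; ∃; _×_)
open import Data.Vec.Relation.Unary.All using (All)
open import Relation.Binary.PropositionalEquality using (_≡_; _≢_)
open import Relation.Nullary using (¬_)

Family : ℕ → Set₁
Family n = Subset n → Set

-- M (identified with its set of bases) is a matroid of rank k on [n]:
-- it has a basis, every basis has exactly k elements, and the basis
-- exchange axiom holds.
record IsMatroid {n : ℕ} (k : ℕ) (M : Family n) : Set where
  field
    nonempty : ∃ λ B → M B
    rank     : ∀ B → M B → ∣ B ∣ ≡ k
    exchange : ∀ B₁ B₂ → M B₁ → M B₂ → ∀ x → x ∈ B₁ → x ∉ B₂ →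
               ∃ λ y → y ∈ B₂ × y ∉ B₁ × M ((B₁ - x) ∪ ⁅ y ⁆)

NonBasis : {n : ℕ} → ℕ → Family n → Subset n → Set
NonBasis k M D = ∣ D ∣ ≡ k × ¬ M D

sideCount : Side → ℕ
sideCount inside  = 1
sideCount outside = 0

mult : {n ℓ : ℕ} → Vec (Subset n) ℓ → Fin n → ℕ
mult Data.Vec.[] i = 0
mult (A Data.Vec.∷ As) i = sideCount (lookup A i) + mult As i

-- sorted concatenation A₁ + ... + A_ℓ : the weakly increasing word over [n]
-- in which each i appears (total multiplicity) times.
sortedConcat : {n ℓ : ℕ} → Vec (Subset n) ℓ → List (Fin n)
sortedConcat {n} As = concatMap (λ i → replicate (mult As i) i) (allFin n)

UniformAssumable : {n : ℕ} → (ℓ k : ℕ) → Family n → Set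
UniformAssumable {n} ℓ k M =
  (Bs Ds : Vec (Subset n) ℓ) → All M Bs → All (NonBasis k M) Ds →
  sortedConcat Bs ≢ sortedConcat Ds

{-# OPTIONS --safe #-}
module Submission where

open import Defs
open import Data.Bool using (true; false; _∨_; _∧_; _≟_)
open import Data.Nat using (ℕ; zero; suc; _+_; _≤ᵇ_)
open import Data.Nat.Properties using (+-identityʳ)
open import Data.Fin using (Fin; zero; suc)
import Data.Fin as Fin
open import Data.Fin.Properties using (suc-injective)
open import Data.Fin.Subset using (Subset; _∪_; _∩_)
open import Data.List using (List; []; _∷_; _++_; replicate; concatMap; map; allFin)
open import Data.List.Properties
  using (∷-injectiveʳ; map-injective; map-tabulate; map-replicate; map-concatMap; concatMap-map; concatMap-cong)
open import Data.Vec using (Vec; []; _∷_; lookup; tabulate)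
open import Data.Vec.Properties using (lookup-zipWith; tabulate∘lookup; tabulate-cong; ≡-dec)
open import Data.Vec.Relation.Unary.All using ([]; _∷_)
open import Data.Product using (_×_; _,_; proj₁; proj₂)
open import Data.Sum using (_⊎_; inj₁; inj₂; [_,_])
open import Function using (_∘_; id)
open import Function.Bundles using (_⇔_; mk⇔; Equivalence)
open import Function.Construct.Composition using (_⇔-∘_)
open import Relation.Nullary using (¬_; Dec; yes; no)
open import Relation.Binary.PropositionalEquality
  using (_≡_; _≢_; _≗_; refl; sym; trans; cong; cong₂; module ≡-Reasoning)

-- Every element of [n] lies in 0, 1 or 2 of the sets A, B, and A + B records exactly these
-- multiplicities (a weakly increasing word is determined by its letter counts). A multiplicity
-- m ≤ 2 is determined by the bits m ≥ 1 and m ≥ 2, i.e. by membership in A ∪ B and in A ∩ B,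
-- and conversely m is their sum.

private variable n : ℕ

¬×⇒¬⊎¬ : ∀ {a b} {P : Set a} {Q : Set b} → Dec P → ¬ (P × Q) → ¬ P ⊎ ¬ Q
¬×⇒¬⊎¬ (yes p) ¬p×q = inj₂ (λ q → ¬p×q (p , q))
¬×⇒¬⊎¬ (no ¬p)  _    = inj₁ ¬p

¬⊎¬⇒¬× : ∀ {a b} {P : Set a} {Q : Set b} → ¬ P ⊎ ¬ Q → ¬ (P × Q)
¬⊎¬⇒¬× = [ _∘ proj₁ , _∘ proj₂ ]

sideCount-+-∨-∧ : ∀ a b → sideCount a + sideCount b ≡ sideCount (a ∨ b) + sideCount (a ∧ b)
sideCount-+-∨-∧ true  true  = refl
sideCount-+-∨-∧ true  false = refl
sideCount-+-∨-∧ false true  = refl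
sideCount-+-∨-∧ false false = refl

∨≡1≤ᵇsideCount-+ : ∀ a b → a ∨ b ≡ (1 ≤ᵇ sideCount a + sideCount b)
∨≡1≤ᵇsideCount-+ true  true  = refl
∨≡1≤ᵇsideCount-+ true  false = refl
∨≡1≤ᵇsideCount-+ false true  = refl
∨≡1≤ᵇsideCount-+ false false = refl

∧≡2≤ᵇsideCount-+ : ∀ a b → a ∧ b ≡ (2 ≤ᵇ sideCount a + sideCount b)
∧≡2≤ᵇsideCount-+ true  true  = refl
∧≡2≤ᵇsideCount-+ true  false = refl
∧≡2≤ᵇsideCount-+ false true  = refl
∧≡2≤ᵇsideCount-+ false false = refl

mult-pair : (A B : Subset n) (i : Fin n) →
            mult (A ∷ B ∷ []) i ≡ sideCount (lookup A i) + sideCount (lookup B i)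
mult-pair A B i = cong (sideCount (lookup A i) +_) (+-identityʳ (sideCount (lookup B i)))

mult-pair-∪-∩ : (A B : Subset n) (i : Fin n) →
                mult (A ∷ B ∷ []) i ≡ sideCount (lookup (A ∪ B) i) + sideCount (lookup (A ∩ B) i)
mult-pair-∪-∩ A B i = begin
  mult (A ∷ B ∷ []) i                                            ≡⟨ mult-pair A B i ⟩
  sideCount (lookup A i) + sideCount (lookup B i)                ≡⟨ sideCount-+-∨-∧ (lookup A i) (lookup B i) ⟩
  sideCount (lookup A i ∨ lookup B i) + sideCount (lookup A i ∧ lookup B i)
    ≡⟨ sym (cong₂ (λ x y → sideCount x + sideCount y) (lookup-zipWith _∨_ i A B) (lookup-zipWith _∧_ i A B)) ⟩
  sideCount (lookup (A ∪ B) i) + sideCount (lookup (A ∩ B) i)    ∎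
  where open ≡-Reasoning

∪≡tabulate-mult : (A B : Subset n) → A ∪ B ≡ tabulate (λ i → 1 ≤ᵇ mult (A ∷ B ∷ []) i)
∪≡tabulate-mult A B = trans (sym (tabulate∘lookup (A ∪ B))) (tabulate-cong λ i → begin
  lookup (A ∪ B) i                                         ≡⟨ lookup-zipWith _∨_ i A B ⟩
  lookup A i ∨ lookup B i                                  ≡⟨ ∨≡1≤ᵇsideCount-+ (lookup A i) (lookup B i) ⟩
  (1 ≤ᵇ sideCount (lookup A i) + sideCount (lookup B i))   ≡⟨ cong (1 ≤ᵇ_) (mult-pair A B i) ⟨
  (1 ≤ᵇ mult (A ∷ B ∷ []) i)                               ∎)
  where open ≡-Reasoning

∩≡tabulate-mult : (A B : Subset n) → A ∩ B ≡ tabulate (λ i → 2 ≤ᵇ mult (A ∷ B ∷ []) i)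
∩≡tabulate-mult A B = trans (sym (tabulate∘lookup (A ∩ B))) (tabulate-cong λ i → begin
  lookup (A ∩ B) i                                         ≡⟨ lookup-zipWith _∧_ i A B ⟩
  lookup A i ∧ lookup B i                                  ≡⟨ ∧≡2≤ᵇsideCount-+ (lookup A i) (lookup B i) ⟩
  (2 ≤ᵇ sideCount (lookup A i) + sideCount (lookup B i))   ≡⟨ cong (2 ≤ᵇ_) (mult-pair A B i) ⟨
  (2 ≤ᵇ mult (A ∷ B ∷ []) i)                               ∎)
  where open ≡-Reasoning

mult-pair-≗⇔∪-∩-≡ : (A B C D : Subset n) →
                    (mult (A ∷ B ∷ []) ≗ mult (C ∷ D ∷ [])) ⇔ (A ∪ B ≡ C ∪ D × A ∩ B ≡ C ∩ D)
mult-pair-≗⇔∪-∩-≡ A B C D = mk⇔ to from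
  where
  to : mult (A ∷ B ∷ []) ≗ mult (C ∷ D ∷ []) → A ∪ B ≡ C ∪ D × A ∩ B ≡ C ∩ D
  to eq =
    trans (∪≡tabulate-mult A B) (trans (tabulate-cong (cong (1 ≤ᵇ_) ∘ eq)) (sym (∪≡tabulate-mult C D))) ,
    trans (∩≡tabulate-mult A B) (trans (tabulate-cong (cong (2 ≤ᵇ_) ∘ eq)) (sym (∩≡tabulate-mult C D)))
  from : A ∪ B ≡ C ∪ D × A ∩ B ≡ C ∩ D → mult (A ∷ B ∷ []) ≗ mult (C ∷ D ∷ [])
  from (∪≡ , ∩≡) i = begin
    mult (A ∷ B ∷ []) i                                           ≡⟨ mult-pair-∪-∩ A B i ⟩
    sideCount (lookup (A ∪ B) i) + sideCount (lookup (A ∩ B) i)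
      ≡⟨ cong₂ (λ X Y → sideCount (lookup X i) + sideCount (lookup Y i)) ∪≡ ∩≡ ⟩
    sideCount (lookup (C ∪ D) i) + sideCount (lookup (C ∩ D) i)   ≡⟨ mult-pair-∪-∩ C D i ⟨
    mult (C ∷ D ∷ []) i                                           ∎
    where open ≡-Reasoning

sortedWord : (Fin n → ℕ) → List (Fin n)
sortedWord {n} f = concatMap (λ i → replicate (f i) i) (allFin n)

sortedWord-cong : {f g : Fin n → ℕ} → f ≗ g → sortedWord f ≡ sortedWord g
sortedWord-cong {n} f≗g = concatMap-cong (λ i → cong (λ m → replicate m i) (f≗g i)) (allFin n)

sortedWord-suc : (f : Fin (suc n) → ℕ) →
                 sortedWord f ≡ replicate (f zero) zero ++ map Fin.suc (sortedWord (f ∘ suc))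
sortedWord-suc {n} f = cong (replicate (f zero) zero ++_) (begin
  concatMap (λ i → replicate (f i) i) (Data.List.tabulate Fin.suc)
    ≡⟨ cong (concatMap (λ i → replicate (f i) i)) (map-tabulate id Fin.suc) ⟨
  concatMap (λ i → replicate (f i) i) (map Fin.suc (allFin n))
    ≡⟨ concatMap-map _ Fin.suc (allFin n) ⟩
  concatMap (λ i → replicate (f (suc i)) (suc i)) (allFin n)
    ≡⟨ concatMap-cong (λ i → map-replicate Fin.suc (f (suc i)) i) (allFin n) ⟨
  concatMap (λ i → map Fin.suc (replicate (f (suc i)) i)) (allFin n)
    ≡⟨ map-concatMap Fin.suc _ (allFin n) ⟨
  map Fin.suc (sortedWord (f ∘ suc))  ∎)
  where open ≡-Reasoning

replicate-zero-++-map-suc-injective : ∀ a b (xs ys : List (Fin n)) →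
  replicate a zero ++ map Fin.suc xs ≡ replicate b zero ++ map Fin.suc ys → a ≡ b × xs ≡ ys
replicate-zero-++-map-suc-injective zero    zero    xs       ys eq = refl , map-injective suc-injective eq
replicate-zero-++-map-suc-injective (suc a) (suc b) xs       ys eq =
  let a≡b , xs≡ys = replicate-zero-++-map-suc-injective a b xs ys (∷-injectiveʳ eq) in cong suc a≡b , xs≡ys
replicate-zero-++-map-suc-injective zero    (suc b) (x ∷ xs) ys ()
replicate-zero-++-map-suc-injective (suc a) zero    xs (y ∷ ys) ()

sortedWord-suc-injective : (f g : Fin (suc n) → ℕ) → sortedWord f ≡ sortedWord g →
                           f zero ≡ g zero × sortedWord (f ∘ suc) ≡ sortedWord (g ∘ suc)
sortedWord-suc-injective f g eq = replicate-zero-++-map-suc-injective (f zero) (g zero) _ _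
  (trans (sym (sortedWord-suc f)) (trans eq (sortedWord-suc g)))

sortedWord-injective : (f g : Fin n → ℕ) → sortedWord f ≡ sortedWord g → f ≗ g
sortedWord-injective f g eq zero    = proj₁ (sortedWord-suc-injective f g eq)
sortedWord-injective f g eq (suc i) =
  sortedWord-injective (f ∘ suc) (g ∘ suc) (proj₂ (sortedWord-suc-injective f g eq)) i

sortedConcat-≡⇔mult-≗ : ∀ {ℓ} (As Ds : Vec (Subset n) ℓ) →
                        (sortedConcat As ≡ sortedConcat Ds) ⇔ (mult As ≗ mult Ds)
sortedConcat-≡⇔mult-≗ As Ds = mk⇔ (sortedWord-injective (mult As) (mult Ds)) sortedWord-cong

sortedConcat-pair-≡⇔∪-∩-≡ : (A B C D : Subset n) →
  (sortedConcat (A ∷ B ∷ []) ≡ sortedConcat (C ∷ D ∷ [])) ⇔ (A ∪ B ≡ C ∪ D × A ∩ B ≡ C ∩ D)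
sortedConcat-pair-≡⇔∪-∩-≡ A B C D =
  mult-pair-≗⇔∪-∩-≡ A B C D ⇔-∘ sortedConcat-≡⇔mult-≗ (A ∷ B ∷ []) (C ∷ D ∷ [])

lemma26 : (n k : ℕ) (M : Family n) → IsMatroid k M →
    UniformAssumable 2 k M ⇔
      ((B₁ B₂ D₁ D₂ : Subset n) → M B₁ → M B₂ → NonBasis k M D₁ → NonBasis k M D₂ →
        (B₁ ∪ B₂ ≢ D₁ ∪ D₂) ⊎ (B₁ ∩ B₂ ≢ D₁ ∩ D₂))
lemma26 n k M _ = mk⇔
  (λ assumable B₁ B₂ D₁ D₂ b₁ b₂ d₁ d₂ →
    ¬×⇒¬⊎¬ (≡-dec _≟_ (B₁ ∪ B₂) (D₁ ∪ D₂))
      (assumable (B₁ ∷ B₂ ∷ []) (D₁ ∷ D₂ ∷ []) (b₁ ∷ b₂ ∷ []) (d₁ ∷ d₂ ∷ [])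
        ∘ Equivalence.from (sortedConcat-pair-≡⇔∪-∩-≡ B₁ B₂ D₁ D₂)))
  (λ { separated (B₁ ∷ B₂ ∷ []) (D₁ ∷ D₂ ∷ []) (b₁ ∷ b₂ ∷ []) (d₁ ∷ d₂ ∷ []) →
    ¬⊎¬⇒¬× (separated B₁ B₂ D₁ D₂ b₁ b₂ d₁ d₂)
      ∘ Equivalence.to (sortedConcat-pair-≡⇔∪-∩-≡ B₁ B₂ D₁ D₂) })
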